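{- Let $B$ be a bipartite graph with bipartition $(U,V)$ such that every vertex of $U$ has degree at most $d$ and such that there are at most $\ell\ge 2$ distinct paths of length at most 4 in $B$ between any two vertices of $V$. Then for every integer $t>\ell$, \[\mathcal{N}(K_{2,t},K(B))\le \ell^{2t} d^{2+t}|U|.\]
   Context: For a bipartite graph $B$ with ordered bipartition $(U,V)$, the clique graph $K(B)$ is the graph with vertex set $V$ in which $v,v'\in V$ are adjacent if and only if they have a common neighbor in $U$ (equivalently, the union of the cliques on $N_B(u)$, $u\in U$). $\mathcal{N}(K_{2,t},G)$ is the number of subgraphs of $G$ isomorphic to the complete bipartite graph $K_{2,t}$. -}

module Defs where

open import Data.Bool using (Bool; true; false; _∧_; _∨_; not; if_then_else_)
open import Data.Nat using (ℕ; zero; suc; _+_; _*_; _<ᵇ_; _≡ᵇ_)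
open import Data.Fin using (Fin; toℕ)
import Data.Fin as Fin
open import Data.Fin.Subset using (Subset; _∈_; ∣_∣)
open import Data.Sum using (_⊎_; inj₁; inj₂)
open import Data.Sum.Properties using (≡-dec)
open import Data.List using (List; []; _∷_; _++_; map; concatMap; allFin)
open import Data.Bool.ListAction using (all; any)
open import Data.Vec using (Vec; []; _∷_; head; last; toList)
open import Relation.Nullary.Decidable using (⌊_⌋)
open import Relation.Binary.PropositionalEquality using (_≡_)

count : {A : Set} → (A → Bool) → List A → ℕ
count p [] = 0
count p (x ∷ xs) = (if p x then 1 else 0) + count p xs

allVecs : {A : Set} → List A → (k : ℕ) → List (Vec A k)
allVecs xs zero = [] ∷ []
allVecs xs (suc k) = concatMap (λ x → map (x ∷_) (allVecs xs k)) xs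

allSubsets : (n : ℕ) → List (Subset n)
allSubsets n = allVecs (true ∷ false ∷ []) n

-- Bipartite graphs B with ordered bipartition (U , V), U = Fin m, V = Fin n.
-- B u v = true  iff  u ∈ U and v ∈ V are adjacent in B.

BipGraph : ℕ → ℕ → Set
BipGraph m n = Fin m → Fin n → Bool

degU : {m n : ℕ} → BipGraph m n → Fin m → ℕ
degU {m} {n} B u = count (λ v → B u v) (allFin n)

Vtx : ℕ → ℕ → Set
Vtx m n = Fin m ⊎ Fin n

allVtx : (m n : ℕ) → List (Vtx m n)
allVtx m n = map inj₁ (allFin m) ++ map inj₂ (allFin n)

adjB : {m n : ℕ} → BipGraph m n → Vtx m n → Vtx m n → Bool
adjB B (inj₁ u) (inj₂ v) = B u v
adjB B (inj₂ v) (inj₁ u) = B u v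
adjB B (inj₁ _) (inj₁ _) = false
adjB B (inj₂ _) (inj₂ _) = false

eqVtx : {m n : ℕ} → Vtx m n → Vtx m n → Bool
eqVtx x y = ⌊ ≡-dec Fin._≟_ Fin._≟_ x y ⌋

distinctB : {m n : ℕ} → List (Vtx m n) → Bool
distinctB [] = true
distinctB (x ∷ xs) = not (any (eqVtx x) xs) ∧ distinctB xs

walkB : {m n : ℕ} → BipGraph m n → List (Vtx m n) → Bool
walkB B [] = true
walkB B (x ∷ []) = true
walkB B (x ∷ y ∷ xs) = adjB B x y ∧ walkB B (y ∷ xs)

-- a path of length k in B from x to y: a sequence of k+1 pairwise distinct
-- vertices x = w₀, w₁, …, w_k = y with consecutive vertices adjacent
isPathB : {m n : ℕ} → BipGraph m n → Vtx m n → Vtx m n → {k : ℕ} → Vec (Vtx m n) (suc k) → Bool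
isPathB B x y w =
  eqVtx (head w) x ∧ eqVtx (last w) y ∧ walkB B (toList w) ∧ distinctB (toList w)

numPathsLen : {m n : ℕ} → BipGraph m n → Vtx m n → Vtx m n → ℕ → ℕ
numPathsLen {m} {n} B x y k = count (isPathB B x y) (allVecs (allVtx m n) (suc k))

numPathsLe4 : {m n : ℕ} → BipGraph m n → Vtx m n → Vtx m n → ℕ
numPathsLe4 B x y =
  numPathsLen B x y 0 + numPathsLen B x y 1 + numPathsLen B x y 2
    + numPathsLen B x y 3 + numPathsLen B x y 4

Graph : ℕ → Set
Graph n = Fin n → Fin n → Bool

cliqueGraph : {m n : ℕ} → BipGraph m n → Graph n
cliqueGraph {m} {n} B v v' =
  not ⌊ v Fin.≟ v' ⌋ ∧ any (λ u → B u v ∧ B u v') (allFin m)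

-- 𝒩(K_{2,t}, G): number of subgraphs of G isomorphic to K_{2,t}.
-- A copy is given by an (unordered) pair {a,b} (a < b) and a t-set T of
-- vertices disjoint from {a,b} with a and b adjacent to every vertex of T.
-- (For t ≠ 2 the pair {a,b} is determined by the subgraph, so this counts
-- each subgraph exactly once.)

memB : {n : ℕ} → Fin n → Subset n → Bool
memB {n} x T = ⌊ Data.Fin.Subset.Properties._∈?_ x T ⌋
  where import Data.Fin.Subset.Properties

isK2t : {n : ℕ} → Graph n → ℕ → Fin n → Fin n → Subset n → Bool
isK2t {n} G t a b T =
  (toℕ a <ᵇ toℕ b) ∧ (∣ T ∣ ≡ᵇ t) ∧ not (memB a T) ∧ not (memB b T)
    ∧ all (λ x → not (memB x T) ∨ (G a x ∧ G b x)) (allFin n)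

numK2t : {n : ℕ} → ℕ → Graph n → ℕ
numK2t {n} t G =
  count (λ abT → isK2t G t (Data.Product.proj₁ abT) (Data.Product.proj₁ (Data.Product.proj₂ abT))
                              (Data.Product.proj₂ (Data.Product.proj₂ abT)))
    (concatMap (λ a → concatMap (λ b → map (λ T → a Data.Product., (b Data.Product., T)) (allSubsets n)) (allFin n)) (allFin n))
  where import Data.Product

{-# OPTIONS --safe #-}
module Submission where

-- A copy of K_{2,t} in K(B) is a pair a < b of V with a t-set of common
-- K(B)-neighbours.  Let codeg(a,b) be the number of common B-neighbours of a and
-- b, and P_k the number of paths of length k from a to b in B; then
-- codeg(a,b) ≤ P₂ and P₂ + P₄ ≤ ℓ.  A common K(B)-neighbour x is either
-- B-adjacent to one of the codeg(a,b) common neighbours (at most codeg(a,b)·d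
-- such x), or it yields a path a u₁ x u₂ b with u₁ ≠ u₂; so there are at most
-- P₄ + codeg(a,b)·d of them.  If codeg(a,b) = 0 this is less than t; otherwise
-- it is at most ℓd and the pair carries at most (ℓd)^t ≤ codeg(a,b)·ℓ^t·d^t
-- copies.  Finally Σ_{a,b} codeg(a,b) = Σ_u deg(u)² ≤ |U|·d².

open import Defs
open import Data.Bool using (Bool; true; false; _∧_; _∨_; not; if_then_else_)
open import Data.Bool.Properties using (∧-conicalˡ; ∧-conicalʳ; ∧-zeroʳ; ∨-zeroʳ; not-injective; ¬-not)
open import Data.Bool.ListAction using (all; any; and)
open import Data.Unit using (tt)
open import Data.Nat using (ℕ; zero; suc; _+_; _*_; _^_; _≤_; _<_; z≤n; s≤s; _<ᵇ_; _≡ᵇ_; NonZero; >-nonZero)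
open import Data.Nat.Properties
open import Data.Nat.Combinatorics using (_C_; nCk+nC[k+1]≡[n+1]C[k+1]; k>n⇒nCk≡0)
open import Data.Nat.Tactic.RingSolver using (solve-∀)
open import Algebra.Properties.CommutativeSemigroup +-commutativeSemigroup using () renaming (interchange to +-interchange)
open import Algebra.Properties.CommutativeSemigroup *-commutativeSemigroup using () renaming (interchange to *-interchange)
open import Data.Fin using (Fin; toℕ) renaming (zero to fzero; suc to fsuc)
import Data.Fin as Fin
open import Data.Fin.Subset using (Subset; ∣_∣)
open import Data.Fin.Subset.Properties using (_∈?_)
open import Data.List using (List; []; _∷_; _++_; map; concatMap; allFin; length)
open import Data.List.Properties using (map-tabulate; length-tabulate; ++-identityʳ)
open import Data.List.Membership.Propositional using (_∈_; lose)
open import Data.List.Membership.Propositional.Properties using (∈-++⁺ˡ; ∈-++⁺ʳ; ∈-map⁺; ∈-allFin; ∈-concatMap⁺)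
open import Data.List.Relation.Unary.Any using (here; there)
import Data.List.Relation.Unary.All as All
open import Data.List.Relation.Unary.AllPairs using (_∷_)
open import Data.List.Relation.Unary.Unique.Propositional using (Unique)
open import Data.List.Relation.Unary.Unique.Propositional.Properties using (allFin⁺)
open import Data.Vec using (Vec; []; _∷_; lookup)
import Data.Vec.Properties as Vecₚ
open import Data.Product using (∃; _,_; proj₁; proj₂)
open import Data.Sum using (inj₁; inj₂)
open import Data.Sum.Properties using (≡-dec; inj₁-injective; inj₂-injective)
open import Function using (_∘_; id)
open import Relation.Binary using (DecidableEquality)
open import Relation.Binary.PropositionalEquality
open import Relation.Nullary using (yes; no; contradiction)
open import Relation.Nullary.Decidable using (⌊_⌋; dec-true; dec-false; isYes≗does)

private
  variable
    X Y : Set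
    k : ℕ

𝟙 : Bool → ℕ
𝟙 b = if b then 1 else 0

𝟙-∧ : ∀ x y → 𝟙 (x ∧ y) ≡ 𝟙 x * 𝟙 y
𝟙-∧ true  y = sym (*-identityˡ (𝟙 y))
𝟙-∧ false y = refl

𝟙-mono : ∀ {x y} → (x ≡ true → y ≡ true) → 𝟙 x ≤ 𝟙 y
𝟙-mono {false} _   = z≤n
𝟙-mono {true}  x⇒y rewrite x⇒y refl = ≤-refl

∑ : List X → (X → ℕ) → ℕ
∑ []       f = 0
∑ (x ∷ xs) f = f x + ∑ xs f

syntax ∑ xs (λ x → e) = ∑[ x ∈ xs ] e

∑-cong : (xs : List X) {f g : X → ℕ} → (∀ x → f x ≡ g x) → ∑ xs f ≡ ∑ xs g
∑-cong []       f≗g = refl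
∑-cong (x ∷ xs) f≗g = cong₂ _+_ (f≗g x) (∑-cong xs f≗g)

∑-mono : (xs : List X) {f g : X → ℕ} → (∀ x → f x ≤ g x) → ∑ xs f ≤ ∑ xs g
∑-mono []       f≤g = z≤n
∑-mono (x ∷ xs) f≤g = +-mono-≤ (f≤g x) (∑-mono xs f≤g)

∑-+ : (xs : List X) (f g : X → ℕ) → ∑[ x ∈ xs ] (f x + g x) ≡ ∑ xs f + ∑ xs g
∑-+ []       f g = refl
∑-+ (x ∷ xs) f g = begin
  f x + g x + ∑[ x ∈ xs ] (f x + g x) ≡⟨ cong (f x + g x +_) (∑-+ xs f g) ⟩
  f x + g x + (∑ xs f + ∑ xs g)       ≡⟨ +-interchange (f x) (g x) (∑ xs f) (∑ xs g) ⟩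
  f x + ∑ xs f + (g x + ∑ xs g)       ∎
  where open ≡-Reasoning

∑-*ˡ : (xs : List X) (c : ℕ) (f : X → ℕ) → ∑[ x ∈ xs ] (c * f x) ≡ c * ∑ xs f
∑-*ˡ []       c f = sym (*-zeroʳ c)
∑-*ˡ (x ∷ xs) c f = trans (cong (c * f x +_) (∑-*ˡ xs c f)) (sym (*-distribˡ-+ c (f x) (∑ xs f)))

∑-*ʳ : (xs : List X) (f : X → ℕ) (c : ℕ) → ∑[ x ∈ xs ] (f x * c) ≡ ∑ xs f * c
∑-*ʳ []       f c = refl
∑-*ʳ (x ∷ xs) f c = trans (cong (f x * c +_) (∑-*ʳ xs f c)) (sym (*-distribʳ-+ c (f x) (∑ xs f)))

∑-zero : (xs : List X) → ∑[ _ ∈ xs ] 0 ≡ 0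
∑-zero []       = refl
∑-zero (x ∷ xs) = ∑-zero xs

∑-swap : (xs : List X) (ys : List Y) (h : X → Y → ℕ) →
         ∑[ x ∈ xs ] ∑[ y ∈ ys ] h x y ≡ ∑[ y ∈ ys ] ∑[ x ∈ xs ] h x y
∑-swap []       ys h = sym (∑-zero ys)
∑-swap (x ∷ xs) ys h =
  trans (cong (∑ ys (h x) +_) (∑-swap xs ys h)) (sym (∑-+ ys (h x) (λ y → ∑[ x ∈ xs ] h x y)))

∑-≤-const : (xs : List X) {f : X → ℕ} {c : ℕ} → (∀ x → f x ≤ c) → ∑ xs f ≤ length xs * c
∑-≤-const []       f≤c = z≤n
∑-≤-const (x ∷ xs) f≤c = +-mono-≤ (f≤c x) (∑-≤-const xs f≤c)

count≡∑𝟙 : (p : X → Bool) (xs : List X) → count p xs ≡ ∑[ x ∈ xs ] 𝟙 (p x)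
count≡∑𝟙 p []       = refl
count≡∑𝟙 p (x ∷ xs) = cong (𝟙 (p x) +_) (count≡∑𝟙 p xs)

count-++ : (p : X → Bool) (xs ys : List X) → count p (xs ++ ys) ≡ count p xs + count p ys
count-++ p []       ys = refl
count-++ p (x ∷ xs) ys = trans (cong (𝟙 (p x) +_) (count-++ p xs ys)) (sym (+-assoc (𝟙 (p x)) _ _))

count-map : (p : Y → Bool) (g : X → Y) (xs : List X) → count p (map g xs) ≡ count (p ∘ g) xs
count-map p g []       = refl
count-map p g (x ∷ xs) = cong (𝟙 (p (g x)) +_) (count-map p g xs)

count-concatMap : (p : Y → Bool) (g : X → List Y) (xs : List X) →
                  count p (concatMap g xs) ≡ ∑[ x ∈ xs ] count p (g x)
count-concatMap p g []       = refl
count-concatMap p g (x ∷ xs) =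
  trans (count-++ p (g x) (concatMap g xs)) (cong (count p (g x) +_) (count-concatMap p g xs))

count-none : {p : X → Bool} (xs : List X) → (∀ x → p x ≡ false) → count p xs ≡ 0
count-none []       p≡false = refl
count-none (x ∷ xs) p≡false rewrite p≡false x = count-none xs p≡false

count-mono : {p q : X → Bool} (xs : List X) → (∀ x → p x ≡ true → q x ≡ true) → count p xs ≤ count q xs
count-mono []       p⇒q = z≤n
count-mono (x ∷ xs) p⇒q = +-mono-≤ (𝟙-mono (p⇒q x)) (count-mono xs p⇒q)

count-∨ : (p q : X → Bool) (xs : List X) → count (λ x → p x ∨ q x) xs ≤ count p xs + count q xs
count-∨ p q []       = z≤n
count-∨ p q (x ∷ xs) = begin
  𝟙 (p x ∨ q x) + count (λ x → p x ∨ q x) xs ≤⟨ +-mono-≤ (𝟙-∨ (p x) (q x)) (count-∨ p q xs) ⟩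
  𝟙 (p x) + 𝟙 (q x) + (count p xs + count q xs) ≡⟨ +-interchange (𝟙 (p x)) (𝟙 (q x)) (count p xs) (count q xs) ⟩
  𝟙 (p x) + count p xs + (𝟙 (q x) + count q xs) ∎
  where
  open ≤-Reasoning
  𝟙-∨ : ∀ a b → 𝟙 (a ∨ b) ≤ 𝟙 a + 𝟙 b
  𝟙-∨ true  b = s≤s z≤n
  𝟙-∨ false b = ≤-refl

count-split : (p q : X → Bool) (xs : List X) → count p xs ≤ count q xs + count (λ x → p x ∧ not (q x)) xs
count-split p q xs = ≤-trans (count-mono xs split) (count-∨ q (λ x → p x ∧ not (q x)) xs)
  where
  split : ∀ x → p x ≡ true → (q x ∨ (p x ∧ not (q x))) ≡ true
  split x px with q x
  ... | true  = refl
  ... | false rewrite px = refl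

count-any≤∑ : (P : Y → X → Bool) (xs : List X) (ys : List Y) →
              count (λ x → any (λ y → P y x) ys) xs ≤ ∑[ y ∈ ys ] count (P y) xs
count-any≤∑ P xs []       = ≤-reflexive (count-none xs (λ _ → refl))
count-any≤∑ P xs (y ∷ ys) =
  ≤-trans (count-∨ (P y) (λ x → any (λ y → P y x) ys) xs) (+-monoʳ-≤ (count (P y) xs) (count-any≤∑ P xs ys))

any-witness : (p : X → Bool) (xs : List X) → any p xs ≡ true → ∃ λ x → p x ≡ true
any-witness p (x ∷ xs) h with p x in px
... | true  = x , px
... | false = any-witness p xs h

any-intro : (p : X → Bool) {x : X} {xs : List X} → x ∈ xs → p x ≡ true → any p xs ≡ true
any-intro p {xs = y ∷ ys} (here refl) px = cong (_∨ any p ys) px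
any-intro p {xs = y ∷ ys} (there x∈ys) px = trans (cong (p y ∨_) (any-intro p x∈ys px)) (∨-zeroʳ (p y))

count-remove : (_≟_ : DecidableEquality X) (q : X → Bool) {y : X} {ys : List X} → y ∈ ys → q y ≡ true →
               suc (count (λ z → q z ∧ not ⌊ z ≟ y ⌋) ys) ≤ count q ys
count-remove _≟_ q {y} {_ ∷ ys} (here refl) qy with y ≟ y
... | no y≢y = contradiction refl y≢y
... | yes _ rewrite qy = s≤s (count-mono ys (λ z → ∧-conicalˡ (q z) _))
count-remove _≟_ q {ys = z ∷ zs} (there y∈zs) qy =
  ≤-trans (≤-reflexive (sym (+-suc _ _)))
          (+-mono-≤ (𝟙-mono (∧-conicalˡ (q z) _)) (count-remove _≟_ q y∈zs qy))

count-≤-injection : (_≟_ : DecidableEquality Y) (p : X → Bool) (q : Y → Bool) {xs : List X} {ys : List Y} →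
  Unique xs →
  (f : ∀ x → p x ≡ true → Y) →
  (∀ x px → f x px ∈ ys) →
  (∀ x → x ∈ xs → ∀ px → q (f x px) ≡ true) →
  (∀ x x′ px px′ → f x px ≡ f x′ px′ → x ≡ x′) →
  count p xs ≤ count q ys
count-≤-injection _≟_ p q {[]} _ f f∈ys qf f-inj = z≤n
count-≤-injection {Y = Y} _≟_ p q {x ∷ xs} (x∉xs ∷ uniq) f f∈ys qf f-inj with p x in px
... | false = count-≤-injection _≟_ p q uniq f f∈ys (λ z z∈xs → qf z (there z∈xs)) f-inj
... | true  = ≤-trans (s≤s (count-≤-injection _≟_ p q′ uniq f f∈ys qf′ f-inj))
                      (count-remove _≟_ q (f∈ys x px) (qf x (here refl) px))
  where
  q′ : Y → Bool
  q′ y = q y ∧ not ⌊ y ≟ f x px ⌋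
  qf′ : ∀ z → z ∈ xs → ∀ pz → q′ (f z pz) ≡ true
  qf′ z z∈xs pz rewrite qf z (there z∈xs) pz with f z pz ≟ f x px
  ... | yes fz≡fx = contradiction (sym (f-inj z x pz px fz≡fx)) (All.lookup x∉xs z∈xs)
  ... | no _ = refl

count-allFin-suc : ∀ {n} (p : Fin (suc n) → Bool) → count p (allFin (suc n)) ≡ 𝟙 (p fzero) + count (p ∘ fsuc) (allFin n)
count-allFin-suc {n} p =
  cong (𝟙 (p fzero) +_) (trans (cong (count p) (sym (map-tabulate id fsuc))) (count-map p fsuc (allFin n)))

all-allFin-suc : ∀ {n} (p : Fin (suc n) → Bool) → all p (allFin (suc n)) ≡ p fzero ∧ all (p ∘ fsuc) (allFin n)
all-allFin-suc {n} p =
  cong (λ bs → p fzero ∧ and bs) (trans (map-tabulate fsuc p) (sym (map-tabulate id (p ∘ fsuc))))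

all-cong : {p q : X → Bool} (xs : List X) → (∀ x → p x ≡ q x) → all p xs ≡ all q xs
all-cong []       p≗q = refl
all-cong (x ∷ xs) p≗q = cong₂ _∧_ (p≗q x) (all-cong xs p≗q)

nCk≤n^k : ∀ n k → n C k ≤ n ^ k
nCk≤n^k n       zero    = ≤-refl
nCk≤n^k zero    (suc k) = z≤n
nCk≤n^k (suc n) (suc k) = begin
  suc n C suc k               ≡⟨ nCk+nC[k+1]≡[n+1]C[k+1] n k ⟨
  n C k + n C suc k           ≤⟨ +-mono-≤ (nCk≤n^k n k) (nCk≤n^k n (suc k)) ⟩
  n ^ k + n * n ^ k           ≤⟨ +-mono-≤ (^-monoˡ-≤ k (n≤1+n n)) (*-monoʳ-≤ n (^-monoˡ-≤ k (n≤1+n n))) ⟩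
  suc n ^ k + n * suc n ^ k   ∎
  where open ≤-Reasoning

^-distribʳ-* : ∀ x y k → (x * y) ^ k ≡ x ^ k * y ^ k
^-distribʳ-* x y zero    = refl
^-distribʳ-* x y (suc k) = trans (cong (x * y *_) (^-distribʳ-* x y k)) (*-interchange x y (x ^ k) (y ^ k))

nCt≤c*[ℓd]^t : ∀ {s p c d ℓ t} → s ≤ p + c * d → p + c ≤ ℓ → ℓ < t → s C t ≤ c * (ℓ * d) ^ t
nCt≤c*[ℓd]^t {c = zero} s≤p p≤ℓ ℓ<t = ≤-reflexive (k>n⇒nCk≡0 (≤-<-trans (≤-trans s≤p p≤ℓ) ℓ<t))
nCt≤c*[ℓd]^t {s} {p} {suc c} {zero} {ℓ} s≤p p+c≤ℓ ℓ<t =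
  ≤-trans (≤-reflexive (k>n⇒nCk≡0 (≤-<-trans s≤ℓ ℓ<t))) z≤n
  where
  s≤ℓ : s ≤ ℓ
  s≤ℓ = ≤-trans s≤p (≤-trans (≤-reflexive (trans (cong (p +_) (*-zeroʳ (suc c))) (+-identityʳ p)))
                             (≤-trans (m≤m+n p (suc c)) p+c≤ℓ))
nCt≤c*[ℓd]^t {s} {p} {suc c} {suc d} {ℓ} {t} s≤p+cd p+c≤ℓ ℓ<t = begin
  s C t                     ≤⟨ nCk≤n^k s t ⟩
  s ^ t                     ≤⟨ ^-monoˡ-≤ t s≤ℓd ⟩
  (ℓ * suc d) ^ t           ≤⟨ m≤n*m _ (suc c) ⟩
  suc c * (ℓ * suc d) ^ t   ∎
  where
  open ≤-Reasoning
  s≤ℓd : s ≤ ℓ * suc d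
  s≤ℓd = begin
    s                         ≤⟨ s≤p+cd ⟩
    p + suc c * suc d         ≤⟨ +-monoˡ-≤ (suc c * suc d) (m≤m*n p (suc d)) ⟩
    p * suc d + suc c * suc d ≡⟨ *-distribʳ-+ (suc d) p (suc c) ⟨
    (p + suc c) * suc d       ≤⟨ *-monoˡ-≤ (suc d) p+c≤ℓ ⟩
    ℓ * suc d                 ∎

_⊆ᵇ_ : {n : ℕ} → Subset n → (Fin n → Bool) → Bool
[]          ⊆ᵇ S = true
(true  ∷ T) ⊆ᵇ S = S fzero ∧ T ⊆ᵇ (S ∘ fsuc)
(false ∷ T) ⊆ᵇ S = T ⊆ᵇ (S ∘ fsuc)

isSubsetOfSize : {n : ℕ} → ℕ → (Fin n → Bool) → Subset n → Bool
isSubsetOfSize t S T = (∣ T ∣ ≡ᵇ t) ∧ T ⊆ᵇ S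

count-allSubsets-suc : ∀ {n} (p : Subset (suc n) → Bool) →
  count p (allSubsets (suc n)) ≡ count (p ∘ (true ∷_)) (allSubsets n) + count (p ∘ (false ∷_)) (allSubsets n)
count-allSubsets-suc {n} p = begin
  count p (map (true ∷_) A ++ map (false ∷_) A ++ [])
    ≡⟨ count-++ p (map (true ∷_) A) _ ⟩
  count p (map (true ∷_) A) + count p (map (false ∷_) A ++ [])
    ≡⟨ cong₂ _+_ (count-map p _ A) (trans (cong (count p) (++-identityʳ (map (false ∷_) A))) (count-map p _ A)) ⟩
  count (p ∘ (true ∷_)) A + count (p ∘ (false ∷_)) A ∎
  where
  open ≡-Reasoning
  A = allSubsets n

count-isSubsetOfSize : ∀ n t (S : Fin n → Bool) → count (isSubsetOfSize t S) (allSubsets n) ≡ count S (allFin n) C t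
count-isSubsetOfSize zero    zero    S = refl
count-isSubsetOfSize zero    (suc t) S = refl
count-isSubsetOfSize (suc n) t       S = begin
  count (isSubsetOfSize t S) (allSubsets (suc n))
    ≡⟨ count-allSubsets-suc (isSubsetOfSize t S) ⟩
  count (isSubsetOfSize t S ∘ (true ∷_)) A + count (isSubsetOfSize t S′) A
    ≡⟨ pascal t (S fzero) ⟩
  (𝟙 (S fzero) + count S′ (allFin n)) C t
    ≡⟨ cong (_C t) (count-allFin-suc S) ⟨
  count S (allFin (suc n)) C t ∎
  where
  open ≡-Reasoning
  A  = allSubsets n
  S′ = S ∘ fsuc
  -- The first summand counts the subsets containing fzero, unfolded so that S fzero can be split on.
  pascal : ∀ t s → count (λ T → (suc ∣ T ∣ ≡ᵇ t) ∧ (s ∧ T ⊆ᵇ S′)) A + count (isSubsetOfSize t S′) A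
                   ≡ (𝟙 s + count S′ (allFin n)) C t
  pascal zero    s     = trans (cong (_+ count (isSubsetOfSize zero S′) A) (count-none A (λ _ → refl))) (count-isSubsetOfSize n zero S′)
  pascal (suc t) true  = trans (cong₂ _+_ (count-isSubsetOfSize n t S′) (count-isSubsetOfSize n (suc t) S′))
                               (nCk+nC[k+1]≡[n+1]C[k+1] (count S′ (allFin n)) t)
  pascal (suc t) false = trans (cong (_+ count (isSubsetOfSize (suc t) S′) A) (count-none A (λ T → ∧-zeroʳ (∣ T ∣ ≡ᵇ t))))
                               (count-isSubsetOfSize n (suc t) S′)

memB-suc : ∀ {n} (x : Fin n) b (T : Subset n) → memB (fsuc x) (b ∷ T) ≡ memB x T
memB-suc x b T with x ∈? T
... | yes _ = refl
... | no  _ = refl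

all-∉∨≡⊆ᵇ : ∀ {n} (T : Subset n) (S : Fin n → Bool) → all (λ x → not (memB x T) ∨ S x) (allFin n) ≡ T ⊆ᵇ S
all-∉∨≡⊆ᵇ []      S = refl
all-∉∨≡⊆ᵇ {suc n} (b ∷ T) S = begin
  all p (allFin (suc n))
    ≡⟨ all-allFin-suc p ⟩
  p fzero ∧ all (λ x → not (memB (fsuc x) (b ∷ T)) ∨ S (fsuc x)) (allFin n)
    ≡⟨ cong (p fzero ∧_) (all-cong (allFin n) (λ x → cong (λ m → not m ∨ S (fsuc x)) (memB-suc x b T))) ⟩
  p fzero ∧ all (λ x → not (memB x T) ∨ S (fsuc x)) (allFin n)
    ≡⟨ cong (p fzero ∧_) (all-∉∨≡⊆ᵇ T (S ∘ fsuc)) ⟩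
  p fzero ∧ T ⊆ᵇ (S ∘ fsuc)
    ≡⟨ head-case b ⟩
  (b ∷ T) ⊆ᵇ S ∎
  where
  open ≡-Reasoning
  p : Fin (suc n) → Bool
  p x = not (memB x (b ∷ T)) ∨ S x
  head-case : ∀ b → (not (memB fzero (b ∷ T)) ∨ S fzero) ∧ T ⊆ᵇ (S ∘ fsuc) ≡ (b ∷ T) ⊆ᵇ S
  head-case true  = refl
  head-case false = refl

commonNeighbour : {n : ℕ} → Graph n → Fin n → Fin n → Fin n → Bool
commonNeighbour G a b x = G a x ∧ G b x

isK2t⇒isSubsetOfSize : ∀ {n} (G : Graph n) t a b (T : Subset n) →
                 isK2t G t a b T ≡ true → isSubsetOfSize t (commonNeighbour G a b) T ≡ true
isK2t⇒isSubsetOfSize G t a b T h with toℕ a <ᵇ toℕ b | ∣ T ∣ ≡ᵇ t | memB a T | memB b T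
... | true  | true  | false | false = trans (sym (all-∉∨≡⊆ᵇ T (commonNeighbour G a b))) h
... | false | _     | _     | _     = contradiction h λ ()
... | true  | false | _     | _     = contradiction h λ ()
... | true  | true  | true  | _     = contradiction h λ ()
... | true  | true  | false | true  = contradiction h λ ()

eqVtx-refl : ∀ {m n} (x : Vtx m n) → eqVtx x x ≡ true
eqVtx-refl x = trans (isYes≗does _) (dec-true (≡-dec Fin._≟_ Fin._≟_ x x) refl)

eqVtx-≢ : ∀ {m n} {x y : Vtx m n} → x ≢ y → eqVtx x y ≡ false
eqVtx-≢ {x = x} {y} x≢y = trans (isYes≗does _) (dec-false (≡-dec Fin._≟_ Fin._≟_ x y) x≢y)

∈-allVtx : ∀ {m n} (x : Vtx m n) → x ∈ allVtx m n
∈-allVtx         (inj₁ u) = ∈-++⁺ˡ (∈-map⁺ inj₁ (∈-allFin u))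
∈-allVtx {m} {n} (inj₂ v) = ∈-++⁺ʳ (map inj₁ (allFin m)) (∈-map⁺ inj₂ (∈-allFin v))

∈-allVecs : {xs : List X} → (∀ x → x ∈ xs) → (v : Vec X k) → v ∈ allVecs xs k
∈-allVecs complete []      = here refl
∈-allVecs complete (x ∷ v) = ∈-concatMap⁺ _ (lose (complete x) (∈-map⁺ (x ∷_) (∈-allVecs complete v)))

count≤numPathsLen : ∀ {m n} (B : BipGraph m n) {s e : Vtx m n} (p : X → Bool) {xs : List X} → Unique xs →
  (path : ∀ x → p x ≡ true → Vec (Vtx m n) (suc k)) →
  (∀ x → x ∈ xs → ∀ px → isPathB B s e (path x px) ≡ true) →
  (∀ x x′ px px′ → path x px ≡ path x′ px′ → x ≡ x′) →
  count p xs ≤ numPathsLen B s e k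
count≤numPathsLen B p uniq path isPath path-inj =
  count-≤-injection (Vecₚ.≡-dec (≡-dec Fin._≟_ Fin._≟_)) p (isPathB B _ _) uniq path
    (λ x px → ∈-allVecs ∈-allVtx (path x px)) isPath path-inj

codegree : {m n : ℕ} → BipGraph m n → Fin n → Fin n → ℕ
codegree {m} B a b = count (λ u → B u a ∧ B u b) (allFin m)

∑∑codegree≡∑degree² : ∀ {m n} (B : BipGraph m n) →
  ∑[ a ∈ allFin n ] ∑[ b ∈ allFin n ] codegree B a b ≡ ∑[ u ∈ allFin m ] (degU B u * degU B u)
∑∑codegree≡∑degree² {m} {n} B = begin
  ∑[ a ∈ Vs ] ∑[ b ∈ Vs ] codegree B a b
    ≡⟨ ∑-cong Vs (λ a → ∑-cong Vs (λ b → trans (count≡∑𝟙 _ Us) (∑-cong Us (λ u → 𝟙-∧ (B u a) (B u b))))) ⟩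
  ∑[ a ∈ Vs ] ∑[ b ∈ Vs ] ∑[ u ∈ Us ] (𝟙 (B u a) * 𝟙 (B u b))
    ≡⟨ ∑-cong Vs (λ a → ∑-swap Vs Us _) ⟩
  ∑[ a ∈ Vs ] ∑[ u ∈ Us ] ∑[ b ∈ Vs ] (𝟙 (B u a) * 𝟙 (B u b))
    ≡⟨ ∑-swap Vs Us _ ⟩
  ∑[ u ∈ Us ] ∑[ a ∈ Vs ] ∑[ b ∈ Vs ] (𝟙 (B u a) * 𝟙 (B u b))
    ≡⟨ ∑-cong Us (λ u → trans (∑-cong Vs (λ a → ∑-*ˡ Vs (𝟙 (B u a)) (𝟙 ∘ B u))) (∑-*ʳ Vs (𝟙 ∘ B u) _)) ⟩
  ∑[ u ∈ Us ] ((∑[ a ∈ Vs ] 𝟙 (B u a)) * (∑[ b ∈ Vs ] 𝟙 (B u b)))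
    ≡⟨ ∑-cong Us (λ u → cong₂ _*_ (count≡∑𝟙 (B u) Vs) (count≡∑𝟙 (B u) Vs)) ⟨
  ∑[ u ∈ Us ] (degU B u * degU B u) ∎
  where
  open ≡-Reasoning
  Us = allFin m
  Vs = allFin n

numPaths₄+numPaths₂≤numPathsLe4 : ∀ {m n} (B : BipGraph m n) x y →
  numPathsLen B x y 4 + numPathsLen B x y 2 ≤ numPathsLe4 B x y
numPaths₄+numPaths₂≤numPathsLe4 B x y =
  ≤-trans (≤-reflexive (+-comm (P 4) (P 2)))
          (+-monoˡ-≤ (P 4) (≤-trans (m≤n+m (P 2) (P 0 + P 1)) (m≤m+n (P 0 + P 1 + P 2) (P 3))))
  where
  P : ℕ → ℕ
  P = numPathsLen B x y

cliqueGraph⇒≢ : ∀ {m n} (B : BipGraph m n) {v v′ : Fin n} → cliqueGraph B v v′ ≡ true → v ≢ v′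
cliqueGraph⇒≢ B {v} {v′} h with v Fin.≟ v′
... | yes _    = contradiction h λ ()
... | no  v≢v′ = v≢v′

cliqueGraph⇒commonNeighbour : ∀ {m n} (B : BipGraph m n) {v v′ : Fin n} →
  cliqueGraph B v v′ ≡ true → ∃ λ u → B u v ∧ B u v′ ≡ true
cliqueGraph⇒commonNeighbour {m} B {v} {v′} h =
  any-witness (λ u → B u v ∧ B u v′) (allFin m) (∧-conicalʳ (not ⌊ v Fin.≟ v′ ⌋) _ h)

module _ {m n : ℕ} (B : BipGraph m n) {a b : Fin n} where

  path₂ : Fin m → Vec (Vtx m n) 3
  path₂ u = inj₂ a ∷ inj₁ u ∷ inj₂ b ∷ []

  path₄ : Fin m → Fin n → Fin m → Vec (Vtx m n) 5
  path₄ u₁ x u₂ = inj₂ a ∷ inj₁ u₁ ∷ inj₂ x ∷ inj₁ u₂ ∷ inj₂ b ∷ []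

  touchesCommonNeighbour : Fin n → Bool
  touchesCommonNeighbour x = any (λ u → (B u a ∧ B u b) ∧ B u x) (allFin m)

  count-touchesCommonNeighbour≤ : ∀ {d} → (∀ u → degU B u ≤ d) →
    count touchesCommonNeighbour (allFin n) ≤ codegree B a b * d
  count-touchesCommonNeighbour≤ {d} deg≤d = begin
    count touchesCommonNeighbour (allFin n)
      ≤⟨ count-any≤∑ (λ u x → (B u a ∧ B u b) ∧ B u x) (allFin n) (allFin m) ⟩
    ∑[ u ∈ allFin m ] count (λ x → (B u a ∧ B u b) ∧ B u x) (allFin n)
      ≤⟨ ∑-mono (allFin m) per-u ⟩
    ∑[ u ∈ allFin m ] (𝟙 (B u a ∧ B u b) * d)
      ≡⟨ ∑-*ʳ (allFin m) (λ u → 𝟙 (B u a ∧ B u b)) d ⟩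
    (∑[ u ∈ allFin m ] 𝟙 (B u a ∧ B u b)) * d
      ≡⟨ cong (_* d) (count≡∑𝟙 (λ u → B u a ∧ B u b) (allFin m)) ⟨
    codegree B a b * d ∎
    where
    open ≤-Reasoning
    per-u : ∀ u → count (λ x → (B u a ∧ B u b) ∧ B u x) (allFin n) ≤ 𝟙 (B u a ∧ B u b) * d
    per-u u with B u a ∧ B u b
    ... | true  = ≤-trans (deg≤d u) (≤-reflexive (sym (+-identityʳ d)))
    ... | false = ≤-reflexive (count-none (allFin n) (λ _ → refl))

  isLonelyCommonNeighbour : Fin n → Bool
  isLonelyCommonNeighbour x = commonNeighbour (cliqueGraph B) a b x ∧ not (touchesCommonNeighbour x)

  module _ (a≢b : a ≢ b) where

    path₂-isPath : ∀ {u} → B u a ≡ true → B u b ≡ true → isPathB B (inj₂ a) (inj₂ b) (path₂ u) ≡ true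
    path₂-isPath Bua Bub
      rewrite eqVtx-refl {m} (inj₂ a) | eqVtx-refl {m} (inj₂ b) | eqVtx-≢ {m} (a≢b ∘ inj₂-injective)
            | Bua | Bub = refl

    codegree≤numPaths₂ : codegree B a b ≤ numPathsLen B (inj₂ a) (inj₂ b) 2
    codegree≤numPaths₂ =
      count≤numPathsLen B _ (allFin⁺ m) (λ u _ → path₂ u)
        (λ u _ Bu → path₂-isPath (∧-conicalˡ (B u a) _ Bu) (∧-conicalʳ (B u a) _ Bu))
        (λ u u′ _ _ eq → inj₁-injective (cong (λ w → lookup w (fsuc fzero)) eq))

    path₄-isPath : ∀ {u₁ x u₂} → a ≢ x → x ≢ b → u₁ ≢ u₂ →
      B u₁ a ≡ true → B u₁ x ≡ true → B u₂ x ≡ true → B u₂ b ≡ true →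
      isPathB B (inj₂ a) (inj₂ b) (path₄ u₁ x u₂) ≡ true
    path₄-isPath a≢x x≢b u₁≢u₂ Bu₁a Bu₁x Bu₂x Bu₂b
      rewrite eqVtx-refl {m} (inj₂ a) | eqVtx-refl {m} (inj₂ b) | eqVtx-≢ {m} (a≢b ∘ inj₂-injective)
            | eqVtx-≢ {m} (a≢x ∘ inj₂-injective) | eqVtx-≢ {m} (x≢b ∘ inj₂-injective)
            | eqVtx-≢ {n = n} (u₁≢u₂ ∘ inj₁-injective)
            | Bu₁a | Bu₁x | Bu₂x | Bu₂b = refl

    module LonelyPath {x : Fin n} (lonely : isLonelyCommonNeighbour x ≡ true) where

      a~x : cliqueGraph B a x ≡ true
      a~x = ∧-conicalˡ _ _ (∧-conicalˡ _ _ lonely)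

      b~x : cliqueGraph B b x ≡ true
      b~x = ∧-conicalʳ (cliqueGraph B a x) _ (∧-conicalˡ _ _ lonely)

      u₁,Bu₁ : ∃ λ u → B u a ∧ B u x ≡ true
      u₁,Bu₁ = cliqueGraph⇒commonNeighbour B a~x

      u₂,Bu₂ : ∃ λ u → B u b ∧ B u x ≡ true
      u₂,Bu₂ = cliqueGraph⇒commonNeighbour B b~x

      u₁ u₂ : Fin m
      u₁ = proj₁ u₁,Bu₁
      u₂ = proj₁ u₂,Bu₂

      Bu₁a : B u₁ a ≡ true
      Bu₁a = ∧-conicalˡ _ _ (proj₂ u₁,Bu₁)
      Bu₁x : B u₁ x ≡ true
      Bu₁x = ∧-conicalʳ (B u₁ a) _ (proj₂ u₁,Bu₁)
      Bu₂b : B u₂ b ≡ true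
      Bu₂b = ∧-conicalˡ _ _ (proj₂ u₂,Bu₂)
      Bu₂x : B u₂ x ≡ true
      Bu₂x = ∧-conicalʳ (B u₂ b) _ (proj₂ u₂,Bu₂)

      -- A common neighbour u₁ = u₂ of a and b would make x touch it.
      u₁≢u₂ : u₁ ≢ u₂
      u₁≢u₂ u₁≡u₂ = contradiction (trans (sym untouched) touched) λ ()
        where
        untouched : touchesCommonNeighbour x ≡ false
        untouched = not-injective (∧-conicalʳ (commonNeighbour (cliqueGraph B) a b x) _ lonely)
        touched : touchesCommonNeighbour x ≡ true
        touched = any-intro _ (∈-allFin u₁)
          (cong₂ _∧_ (cong₂ _∧_ Bu₁a (subst (λ u → B u b ≡ true) (sym u₁≡u₂) Bu₂b)) Bu₁x)

      path : Vec (Vtx m n) 5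
      path = path₄ u₁ x u₂

      isPath : isPathB B (inj₂ a) (inj₂ b) path ≡ true
      isPath = path₄-isPath (cliqueGraph⇒≢ B a~x) (cliqueGraph⇒≢ B b~x ∘ sym) u₁≢u₂ Bu₁a Bu₁x Bu₂x Bu₂b

    count-lonely≤numPaths₄ : count isLonelyCommonNeighbour (allFin n) ≤ numPathsLen B (inj₂ a) (inj₂ b) 4
    count-lonely≤numPaths₄ =
      count≤numPathsLen B _ (allFin⁺ n) (λ _ → LonelyPath.path) (λ _ _ → LonelyPath.isPath)
        (λ x x′ _ _ eq → inj₂-injective (cong (λ w → lookup w (fsuc (fsuc fzero))) eq))

    count-commonNeighbour≤ : ∀ {d} → (∀ u → degU B u ≤ d) →
      count (commonNeighbour (cliqueGraph B) a b) (allFin n) ≤ numPathsLen B (inj₂ a) (inj₂ b) 4 + codegree B a b * d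
    count-commonNeighbour≤ {d} deg≤d =
      ≤-trans (count-split (commonNeighbour (cliqueGraph B) a b) touchesCommonNeighbour (allFin n))
              (≤-trans (+-mono-≤ (count-touchesCommonNeighbour≤ deg≤d) count-lonely≤numPaths₄)
                       (≤-reflexive (+-comm (codegree B a b * d) _)))

n<ᵇn≡false : ∀ n → (n <ᵇ n) ≡ false
n<ᵇn≡false n = ¬-not (λ n<n → <-irrefl refl (<ᵇ⇒< n n (subst Data.Bool.T (sym n<n) tt)))

count-K2t-at-pair≤ : ∀ {m n d ℓ t} (B : BipGraph m n) →
  (∀ u → degU B u ≤ d) →
  (∀ v v′ → v ≢ v′ → numPathsLe4 B (inj₂ v) (inj₂ v′) ≤ ℓ) →
  ℓ < t →
  ∀ a b → count (isK2t (cliqueGraph B) t a b) (allSubsets n) ≤ codegree B a b * (ℓ * d) ^ t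
count-K2t-at-pair≤ {n = n} {d} {ℓ} {t} B deg≤d paths≤ℓ ℓ<t a b with a Fin.≟ b
... | yes refl = ≤-trans (≤-reflexive (count-none (allSubsets n) diagonal)) z≤n
  where
  diagonal : ∀ T → isK2t (cliqueGraph B) t a a T ≡ false
  diagonal T rewrite n<ᵇn≡false (toℕ a) = refl
... | no a≢b = begin
  count (isK2t G t a b) (allSubsets n)
    ≤⟨ count-mono (allSubsets n) (isK2t⇒isSubsetOfSize G t a b) ⟩
  count (isSubsetOfSize t (commonNeighbour G a b)) (allSubsets n)
    ≡⟨ count-isSubsetOfSize n t (commonNeighbour G a b) ⟩
  count (commonNeighbour G a b) (allFin n) C t
    ≤⟨ nCt≤c*[ℓd]^t {p = P₄} (count-commonNeighbour≤ B a≢b deg≤d) P₄+codeg≤ℓ ℓ<t ⟩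
  codegree B a b * (ℓ * d) ^ t ∎
  where
  open ≤-Reasoning
  G = cliqueGraph B
  P₄ = numPathsLen B (inj₂ a) (inj₂ b) 4
  P₄+codeg≤ℓ : P₄ + codegree B a b ≤ ℓ
  P₄+codeg≤ℓ = ≤-trans (+-monoʳ-≤ _ (codegree≤numPaths₂ B a≢b))
                       (≤-trans (numPaths₄+numPaths₂≤numPathsLe4 B _ _) (paths≤ℓ a b a≢b))

numK2t≡∑∑ : ∀ {n} t (G : Graph n) →
  numK2t t G ≡ ∑[ a ∈ allFin n ] ∑[ b ∈ allFin n ] count (isK2t G t a b) (allSubsets n)
numK2t≡∑∑ {n} t G =
  trans (count-concatMap _ _ (allFin n))
        (∑-cong (allFin n) λ a → trans (count-concatMap _ _ (allFin n))
                                       (∑-cong (allFin n) λ b → count-map _ _ (allSubsets n)))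

m*d²*[ℓd]^t≤ℓ^2t*d^[2+t]*m : ∀ m d ℓ t → .{{NonZero ℓ}} → m * (d * d) * (ℓ * d) ^ t ≤ ℓ ^ (2 * t) * d ^ (2 + t) * m
m*d²*[ℓd]^t≤ℓ^2t*d^[2+t]*m m d ℓ t = begin
  m * (d * d) * (ℓ * d) ^ t
    ≡⟨ cong (m * (d * d) *_) (^-distribʳ-* ℓ d t) ⟩
  m * (d * d) * (ℓ ^ t * d ^ t)
    ≤⟨ *-monoʳ-≤ (m * (d * d)) (*-monoˡ-≤ (d ^ t) (^-monoʳ-≤ ℓ (m≤m+n t (t + 0)))) ⟩
  m * (d * d) * (ℓ ^ (2 * t) * d ^ t)
    ≡⟨ shuffle m d (ℓ ^ (2 * t)) (d ^ t) ⟩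
  ℓ ^ (2 * t) * d ^ (2 + t) * m ∎
  where
  open ≤-Reasoning
  shuffle : ∀ m d L D → m * (d * d) * (L * D) ≡ L * (d * (d * D)) * m
  shuffle = solve-∀

lemma3p6 : (m n d ℓ t : ℕ) (B : BipGraph m n)
    → (∀ (u : Fin m) → degU B u ≤ d)
    → 2 ≤ ℓ
    → (∀ (v v' : Fin n) → v ≢ v' → numPathsLe4 B (inj₂ v) (inj₂ v') ≤ ℓ)
    → ℓ < t
    → numK2t t (cliqueGraph B) ≤ ℓ ^ (2 * t) * d ^ (2 + t) * m
lemma3p6 m n d ℓ t B deg≤d 2≤ℓ paths≤ℓ ℓ<t = begin
  numK2t t (cliqueGraph B)
    ≡⟨ numK2t≡∑∑ t (cliqueGraph B) ⟩
  ∑[ a ∈ Vs ] ∑[ b ∈ Vs ] count (isK2t (cliqueGraph B) t a b) (allSubsets n)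
    ≤⟨ ∑-mono Vs (λ a → ∑-mono Vs (count-K2t-at-pair≤ B deg≤d paths≤ℓ ℓ<t a)) ⟩
  ∑[ a ∈ Vs ] ∑[ b ∈ Vs ] (codegree B a b * K)
    ≡⟨ trans (∑-cong Vs (λ a → ∑-*ʳ Vs (codegree B a) K)) (∑-*ʳ Vs _ K) ⟩
  (∑[ a ∈ Vs ] ∑[ b ∈ Vs ] codegree B a b) * K
    ≡⟨ cong (_* K) (∑∑codegree≡∑degree² B) ⟩
  (∑[ u ∈ allFin m ] (degU B u * degU B u)) * K
    ≤⟨ *-monoˡ-≤ K (∑-≤-const (allFin m) (λ u → *-mono-≤ (deg≤d u) (deg≤d u))) ⟩
  length (allFin m) * (d * d) * K
    ≡⟨ cong (λ k → k * (d * d) * K) (length-tabulate {n = m} id) ⟩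
  m * (d * d) * K
    ≤⟨ m*d²*[ℓd]^t≤ℓ^2t*d^[2+t]*m m d ℓ t {{>-nonZero (≤-trans (s≤s z≤n) 2≤ℓ)}} ⟩
  ℓ ^ (2 * t) * d ^ (2 + t) * m ∎
  where
  open ≤-Reasoning
  Vs = allFin n
  K = (ℓ * d) ^ t
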